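{- Let $v_3\ge5$, $\mathbf{v}=(6,5,v_3)$ and $\mathbf{k}=(2,1,1)$. Then $D(\mathbf{v},\mathbf{k},2)=13$ if $v_3=5$, and $D(\mathbf{v},\mathbf{k},2)=15$ if $v_3\ge6$.
   Context: Let $X_1,X_2,X_3$ be pairwise disjoint sets with $|X_i|=v_i$. A block is a triple $(B,\{x\},\{y\})$ with $B$ a $2$-subset of $X_1$, $x\in X_2$, $y\in X_3$. A $2$-$(\mathbf{v},(2,1,1),1)$ generalized packing is a family of blocks such that: each $2$-subset of $X_1$ is the first coordinate of at most one block; for each $a\in X_1$, $x\in X_2$ at most one block has $a\in B$ and second coordinate $\{x\}$; for each $a\in X_1$, $y\in X_3$ at most one block has $a\in B$ and third coordinate $\{y\}$; and for each $x\in X_2$, $y\in X_3$ at most one block has coordinates $\{x\},\{y\}$. $D(\mathbf{v},\mathbf{k},2)$ is the maximum number of blocks in such a generalized packing. -}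

module Defs where

open import Data.Nat using (ℕ; _<_; _≤_)
open import Data.Fin using (Fin; toℕ)
open import Data.List using (List; length; lookup)
open import Data.Product using (_×_; Σ; ∃; _,_)
open import Relation.Binary.PropositionalEquality using (_≡_)

-- X₁ = Fin v₁, X₂ = Fin v₂, X₃ = Fin v₃.
-- A block (B, {x}, {y}): B = {a , b} a 2-subset of X₁, represented
-- canonically by its two elements a < b.
record Block (v₁ v₂ v₃ : ℕ) : Set where
  constructor block
  field
    fst₁ : Fin v₁
    snd₁ : Fin v₁
    ordered : toℕ fst₁ < toℕ snd₁
    x : Fin v₂
    y : Fin v₃

open Block public

_∈B_ : ∀ {v₁ v₂ v₃} → Fin v₁ → Block v₁ v₂ v₃ → Set
a ∈B β = (a ≡ fst₁ β) Data.Sum.⊎ (a ≡ snd₁ β)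
  where import Data.Sum

SameB : ∀ {v₁ v₂ v₃} → Block v₁ v₂ v₃ → Block v₁ v₂ v₃ → Set
SameB β γ = (fst₁ β ≡ fst₁ γ) × (snd₁ β ≡ snd₁ γ)

-- A family of blocks is a list; "at most one block with property P"
-- means any two positions both satisfying P coincide.
AtMostOne : ∀ {A : Set} (L : List A) → (Data.Fin.Fin (length L) → Set) → Set
AtMostOne L P = ∀ i j → P i → P j → i ≡ j

record IsPacking {v₁ v₂ v₃ : ℕ} (L : List (Block v₁ v₂ v₃)) : Set where
  field
    cond-B  : ∀ (a b : Fin v₁) → toℕ a < toℕ b →
              AtMostOne L (λ i → (fst₁ (lookup L i) ≡ a) × (snd₁ (lookup L i) ≡ b))
    cond-12 : ∀ (a : Fin v₁) (x₀ : Fin v₂) →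
              AtMostOne L (λ i → (a ∈B lookup L i) × (x (lookup L i) ≡ x₀))
    cond-13 : ∀ (a : Fin v₁) (y₀ : Fin v₃) →
              AtMostOne L (λ i → (a ∈B lookup L i) × (y (lookup L i) ≡ y₀))
    cond-23 : ∀ (x₀ : Fin v₂) (y₀ : Fin v₃) →
              AtMostOne L (λ i → (x (lookup L i) ≡ x₀) × (y (lookup L i) ≡ y₀))

IsD : ℕ → ℕ → ℕ → ℕ → Set
IsD v₁ v₂ v₃ n =
  (Σ (List (Block v₁ v₂ v₃)) λ L → IsPacking L × (length L ≡ n)) ×
  (∀ (L : List (Block v₁ v₂ v₃)) → IsPacking L → length L ≤ n)

module Submission where

-- Identify the 2-subsets of X₁ = Fin 6 with the 15 edges of K₆.  By the
-- first packing condition distinct blocks sit on distinct edges, so a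
-- packing has at most 15 blocks.  Forgetting the edges, a packing is an
-- "array": each edge carries at most one cell (x , y) of X₂ × X₃, distinct
-- edges carry distinct cells, and edges meeting in a vertex carry cells in
-- distinct rows and distinct columns.
--
-- For v₃ = 5 a packing with two unused edges has at most 13 blocks.  If at
-- most one edge is unused, one of the vertices 0, 1, 2 has all five of its
-- edges used; their cells lie in distinct rows and columns, so after
-- permuting X₂ and X₃ the k-th edge at that vertex carries the cell (k , k).
-- An exhaustive backtracking search, proved complete below, shows that no
-- such normalised array exists.  The lower bounds are explicit packings of
-- size 13 (v₃ = 5) and 15 (v₃ = 6, transported to every v₃ ≥ 6 by
-- embedding X₃), checked by a decision procedure for the packing property.

open import Defs
open import Data.Bool using (Bool; true; false; T; not; _∧_; _∨_)
open import Data.Bool.ListAction using (any)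
open import Data.Bool.Properties using (T-∧; T-∨)
open import Data.Empty using (⊥; ⊥-elim)
open import Data.Fin using (Fin; zero; suc; toℕ; #_; punchOut; cast; inject≤)
open import Data.Fin.Patterns using (0F; 1F; 2F)
open import Data.Fin.Properties
  using (_≟_; all?; any?; injective⇒≤; punchOut-injective; toℕ-injective; toℕ-cast; inject≤-injective)
open import Data.List using (List; []; _∷_; map; filter; allFin; cartesianProduct; length; lookup)
open import Data.List.Membership.Propositional using (_∈_; lose)
open import Data.List.Membership.Propositional.Properties using (∈-map⁺; ∈-cartesianProduct⁺; ∈-allFin)
open import Data.List.Properties using (map-∘; map-cong; length-map)
open import Data.List.Relation.Unary.Any using (here; there)
open import Data.List.Relation.Unary.Any.Properties using (any⁺)
open import Data.Maybe using (Maybe; just; nothing)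
open import Data.Nat using (ℕ; suc; _≤_; _<_; _<?_)
open import Data.Nat.Properties using (1+n≰n)
open import Data.Product using (_×_; _,_; proj₁; proj₂; ∃; ∃₂)
open import Data.Product.Properties using (≡-dec)
open import Data.Sum using (_⊎_; inj₁; inj₂)
open import Data.Unit using (⊤; tt)
open import Function using (_∘_; Injective)
open import Function.Bundles using (Equivalence)
open import Relation.Binary.PropositionalEquality
  using (_≡_; _≢_; refl; sym; trans; cong; cong₂; subst; module ≡-Reasoning)
open import Relation.Nullary using (¬_; Dec; yes; no)
open import Relation.Nullary.Decidable
  using (from-yes; decidable-stable; map′; ¬?; _×-dec_; _⊎-dec_; _→-dec_)
open import Level using (0ℓ)
open import Relation.Unary using (Pred; Decidable)

module Squeeze {n m} {f : Fin n → Fin (suc m)} {c : Fin (suc m)} (f≢c : ∀ i → f i ≢ c) where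

  squeeze : Fin n → Fin m
  squeeze i = punchOut (f≢c i ∘ sym)

  squeeze-injective : Injective _≡_ _≡_ f → Injective _≡_ _≡_ squeeze
  squeeze-injective f-inj eq = f-inj (punchOut-injective (f≢c _ ∘ sym) (f≢c _ ∘ sym) eq)

missing⇒≤ : ∀ {n m} {f : Fin n → Fin (suc m)} {c : Fin (suc m)} →
  Injective _≡_ _≡_ f → (∀ i → f i ≢ c) → n ≤ m
missing⇒≤ f-inj f≢c = injective⇒≤ (squeeze-injective f-inj)
  where open Squeeze f≢c

-- Missing two distinct points: the squeezed map still misses the image of the second.
missing-two⇒≤ : ∀ {n m} {f : Fin n → Fin (suc (suc m))} {c d : Fin (suc (suc m))} →
  Injective _≡_ _≡_ f → c ≢ d → (∀ i → f i ≢ c) → (∀ i → f i ≢ d) → n ≤ m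
missing-two⇒≤ f-inj c≢d f≢c f≢d = missing⇒≤ (squeeze-injective f-inj) squeeze-misses-d
  where
  open Squeeze f≢c
  squeeze-misses-d : ∀ i → squeeze i ≢ punchOut c≢d
  squeeze-misses-d i eq = f≢d i (punchOut-injective (f≢c i ∘ sym) c≢d eq)

injective⇒surjective : ∀ {n} {f : Fin n → Fin n} → Injective _≡_ _≡_ f → ∀ c → ∃ λ k → f k ≡ c
injective⇒surjective {suc n} {f} f-inj c with any? (λ k → f k ≟ c)
... | yes hit = hit
... | no miss = ⊥-elim (1+n≰n (missing⇒≤ f-inj (λ k eq → miss (k , eq))))

module Inverse {n} {f : Fin n → Fin n} (f-inj : Injective _≡_ _≡_ f) where

  inv : Fin n → Fin n
  inv c = proj₁ (injective⇒surjective f-inj c)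

  inv-right : ∀ c → f (inv c) ≡ c
  inv-right c = proj₂ (injective⇒surjective f-inj c)

  inv-left : ∀ k → inv (f k) ≡ k
  inv-left k = f-inj (inv-right (f k))

  inv-injective : Injective _≡_ _≡_ inv
  inv-injective {c} {d} eq = trans (sym (inv-right c)) (trans (cong f eq) (inv-right d))

twoFailures⊎atMostOne : ∀ {m ℓ} {P : Pred (Fin m) ℓ} → Decidable P →
  (∃₂ λ a b → a ≢ b × ¬ P a × ¬ P b) ⊎ (∀ a b → ¬ P a → ¬ P b → a ≡ b)
twoFailures⊎atMostOne P? with any? (λ a → any? (λ b → ¬? (a ≟ b) ×-dec ¬? (P? a) ×-dec ¬? (P? b)))
... | yes (a , b , failures) = inj₁ (a , b , failures)
... | no none = inj₂ λ a b ¬Pa ¬Pb → decidable-stable (a ≟ b) (λ a≢b → none (a , b , a≢b , ¬Pa , ¬Pb))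

Vertex : Set
Vertex = Fin 6

Edge : Set
Edge = Fin 15

ends : Edge → Vertex × Vertex
ends = lookup
  ((# 0 , # 1) ∷ (# 0 , # 2) ∷ (# 0 , # 3) ∷ (# 0 , # 4) ∷ (# 0 , # 5) ∷
   (# 1 , # 2) ∷ (# 1 , # 3) ∷ (# 1 , # 4) ∷ (# 1 , # 5) ∷
   (# 2 , # 3) ∷ (# 2 , # 4) ∷ (# 2 , # 5) ∷
   (# 3 , # 4) ∷ (# 3 , # 5) ∷ (# 4 , # 5) ∷ [])

_∈ₚ_ : Vertex → Vertex × Vertex → Set
a ∈ₚ (p , q) = a ≡ p ⊎ a ≡ q

_∈ₚ?_ : ∀ a e → Dec (a ∈ₚ e)
a ∈ₚ? (p , q) = (a ≟ p) ⊎-dec (a ≟ q)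

Meet : Vertex × Vertex → Vertex × Vertex → Set
Meet e e' = ∃ λ a → a ∈ₚ e × a ∈ₚ e'

centre : Fin 3 → Vertex
centre 0F = # 0
centre 1F = # 1
centre 2F = # 2

star : Fin 3 → Fin 5 → Edge
star 0F = lookup (# 0 ∷ # 1 ∷ # 2 ∷ # 3 ∷ # 4 ∷ [])
star 1F = lookup (# 0 ∷ # 5 ∷ # 6 ∷ # 7 ∷ # 8 ∷ [])
star 2F = lookup (# 1 ∷ # 5 ∷ # 9 ∷ # 10 ∷ # 11 ∷ [])

-- Finite facts about these tables, each decided by exhaustive evaluation
-- (abstract, so that the decision terms are never unfolded again).

abstract
  ends-ordered : ∀ e → toℕ (proj₁ (ends e)) < toℕ (proj₂ (ends e))
  ends-ordered = from-yes (all? λ e → toℕ (proj₁ (ends e)) <? toℕ (proj₂ (ends e)))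

  edgeOf : ∀ a b → toℕ a < toℕ b → ∃ λ e → ends e ≡ (a , b)
  edgeOf = from-yes (all? λ a → all? λ b → (toℕ a <? toℕ b) →-dec any? (λ e → ≡-dec _≟_ _≟_ (ends e) (a , b)))

  centre∈star : ∀ v k → centre v ∈ₚ ends (star v k)
  centre∈star = from-yes (all? λ v → all? λ k → centre v ∈ₚ? ends (star v k))

  star-injective : ∀ v → Injective _≡_ _≡_ (star v)
  star-injective v {k} {k'} = from-yes (all? λ v → all? λ k → all? λ k' → (star v k ≟ star v k') →-dec (k ≟ k')) v k k'

  -- An edge has two ends, so it avoids the star of one of three centres.
  star-avoiding : ∀ e → ∃ λ v → ∀ k → star v k ≢ e
  star-avoiding = from-yes (all? λ e → any? λ v → all? λ k → ¬? (star v k ≟ e))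

full-star : ∀ {ℓ} {P : Pred Edge ℓ} → Decidable P → (∀ e e' → ¬ P e → ¬ P e' → e ≡ e') →
  ∃ λ v → ∀ k → P (star v k)
full-star P? atMostOne with any? (λ e → ¬? (P? e))
... | no none = 0F , λ k → decidable-stable (P? _) (λ ¬P → none (_ , ¬P))
... | yes (e , ¬Pe) with star-avoiding e
...   | v , avoids = v , λ k → decidable-stable (P? _) (λ ¬P → avoids k (atMostOne _ _ ¬P ¬Pe))

-- An entry records the cell (row , column) carried by an edge, if any.
Entry : ℕ → ℕ → Set
Entry r c = Maybe (Fin r × Fin c)

Compatible : ∀ {r c} → Vertex × Vertex → Entry r c → Vertex × Vertex → Entry r c → Set
Compatible e nothing e' nothing = ⊥
Compatible e nothing e' (just _) = ⊤
Compatible e (just _) e' nothing = ⊤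
Compatible e (just (x , y)) e' (just (x' , y')) =
  ¬ (x ≡ x' × y ≡ y') × (Meet e e' → x ≢ x' × y ≢ y')

-- An array with at most one empty edge, in which any two edges are compatible.
ValidArray : ∀ {r c} → (Edge → Entry r c) → Set
ValidArray ψ = ∀ e e' → e ≢ e' → Compatible (ends e) (ψ e) (ends e') (ψ e')

relabel : ∀ {r c} → (Fin r → Fin r) → (Fin c → Fin c) → Entry r c → Entry r c
relabel ρ σ nothing = nothing
relabel ρ σ (just (x , y)) = just (ρ x , σ y)

relabel-compatible : ∀ {r c} {ρ : Fin r → Fin r} {σ : Fin c → Fin c} →
  Injective _≡_ _≡_ ρ → Injective _≡_ _≡_ σ →
  ∀ e (a : Entry r c) e' a' → Compatible e a e' a' → Compatible e (relabel ρ σ a) e' (relabel ρ σ a')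
relabel-compatible ρ-inj σ-inj e nothing e' (just _) _ = tt
relabel-compatible ρ-inj σ-inj e (just _) e' nothing _ = tt
relabel-compatible ρ-inj σ-inj e (just _) e' (just _) (distinct , separated) =
    (λ (same-row , same-col) → distinct (ρ-inj same-row , σ-inj same-col))
  , (λ meet → let (x≢x' , y≢y') = separated meet in x≢x' ∘ ρ-inj , y≢y' ∘ σ-inj)

Normalised : Fin 3 → (Edge → Entry 5 5) → Set
Normalised v ψ = ∀ k → ψ (star v k) ≡ just (k , k)

-- If every edge at a centre is occupied, relabelling rows and columns
-- normalises a valid array: those five cells lie in distinct rows and columns.
normalise : ∀ {ψ : Edge → Entry 5 5} v → ValidArray ψ → (∀ k → ∃ λ cell → ψ (star v k) ≡ just cell) →
  ∃ λ ψ' → ValidArray ψ' × Normalised v ψ'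
normalise {ψ} v valid occupied = relabel ρ σ ∘ ψ , valid' , diagonal
  where
  row col : Fin 5 → Fin 5
  row k = proj₁ (proj₁ (occupied k))
  col k = proj₂ (proj₁ (occupied k))

  star-meet : ∀ k k' → Meet (ends (star v k)) (ends (star v k'))
  star-meet k k' = centre v , centre∈star v k , centre∈star v k'

  separated : ∀ k k' → (row k ≡ row k' → k ≡ k') × (col k ≡ col k' → k ≡ k')
  separated k k' with k ≟ k'
  ... | yes k≡k' = (λ _ → k≡k') , (λ _ → k≡k')
  ... | no k≢k' with valid (star v k) (star v k') (k≢k' ∘ star-injective v)
  ...   | compatible rewrite proj₂ (occupied k) | proj₂ (occupied k') =
    let (row≢ , col≢) = proj₂ compatible (star-meet k k') in ⊥-elim ∘ row≢ , ⊥-elim ∘ col≢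

  open Inverse {f = row} (λ {k} {k'} → proj₁ (separated k k'))
    renaming (inv to ρ; inv-left to ρ-row; inv-injective to ρ-injective)
  open Inverse {f = col} (λ {k} {k'} → proj₂ (separated k k'))
    renaming (inv to σ; inv-left to σ-col; inv-injective to σ-injective)

  valid' : ValidArray (relabel ρ σ ∘ ψ)
  valid' e e' e≢e' = relabel-compatible ρ-injective σ-injective _ (ψ e) _ (ψ e') (valid e e' e≢e')

  diagonal : Normalised v (relabel ρ σ ∘ ψ)
  diagonal k rewrite proj₂ (occupied k) = cong just (cong₂ _,_ (ρ-row k) (σ-col k))

-- Searching for f : E → A such that every two elements e, e' with distinct
-- keys pass a Boolean test ok.  The search sees an element only through its
-- key, computed once per node; `placed` holds the decisions made so far.
module Backtrack {E K A : Set} (key : E → K) (_≈_ : K → K → Bool)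
  (ok : K → A → K → A → Bool) (choices : List A) where

  fits : K → A → List (K × A) → Bool
  fits k a [] = true
  fits k a ((k' , a') ∷ placed) = ((k ≈ k') ∨ ok k a k' a') ∧ fits k a placed

  extendable : List (K × A) → List E → Bool
  extendable placed [] = true
  extendable placed (e ∷ es) = extendAt (key e)
    where
    extendAt : K → Bool
    extendAt k = any (λ a → fits k a placed ∧ extendable ((k , a) ∷ placed) es) choices

  graph : (E → A) → List E → List (K × A)
  graph f = map (λ e → key e , f e)

  module _ (f : E → A) (f-choice : ∀ e → f e ∈ choices)
    (f-solution : ∀ e e' → T ((key e ≈ key e') ∨ ok (key e) (f e) (key e') (f e'))) where

    fits-solution : ∀ e placed → T (fits (key e) (f e) (graph f placed))
    fits-solution e [] = tt
    fits-solution e (e' ∷ placed) = Equivalence.from T-∧ (f-solution e e' , fits-solution e placed)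

    extendable-solution : ∀ placed es → T (extendable (graph f placed) es)
    extendable-solution placed [] = tt
    extendable-solution placed (e ∷ es) =
      any⁺ _ (lose (f-choice e) (Equivalence.from T-∧ (fits-solution e placed , extendable-solution (e ∷ placed) es)))

-- Boolean versions of the relations above, fast to evaluate in the search.
-- Only completeness (relation ⇒ test succeeds) is needed.
_==_ : ∀ {n} → Fin n → Fin n → Bool
zero == zero = true
suc a == suc b = a == b
_ == _ = false

==-refl : ∀ {n} (a : Fin n) → T (a == a)
==-refl zero = tt
==-refl (suc a) = ==-refl a

==⇒≡ : ∀ {n} {a b : Fin n} → T (a == b) → a ≡ b
==⇒≡ {a = zero} {zero} _ = refl
==⇒≡ {a = suc a} {suc b} t = cong suc (==⇒≡ t)

¬T⇒T-not : ∀ {b} → ¬ T b → T (not b)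
¬T⇒T-not {false} _ = tt
¬T⇒T-not {true} ¬t = ¬t tt

≢⇒T-not== : ∀ {n} {a b : Fin n} → a ≢ b → T (not (a == b))
≢⇒T-not== a≢b = ¬T⇒T-not (a≢b ∘ ==⇒≡)

_≈ₚ_ : Vertex × Vertex → Vertex × Vertex → Bool
(p , q) ≈ₚ (p' , q') = (p == p') ∧ (q == q')

≈ₚ-refl : ∀ e → T (e ≈ₚ e)
≈ₚ-refl (p , q) = Equivalence.from T-∧ (==-refl p , ==-refl q)

_∈ᵇ_ : Vertex → Vertex × Vertex → Bool
a ∈ᵇ (p , q) = (a == p) ∨ (a == q)

∈ᵇ-sound : ∀ {a} e → T (a ∈ᵇ e) → a ∈ₚ e
∈ᵇ-sound _ t with Equivalence.to T-∨ t
... | inj₁ a=p = inj₁ (==⇒≡ a=p)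
... | inj₂ a=q = inj₂ (==⇒≡ a=q)

meetsᵇ : Vertex × Vertex → Vertex × Vertex → Bool
meetsᵇ (p , q) e' = (p ∈ᵇ e') ∨ (q ∈ᵇ e')

meetsᵇ-sound : ∀ e e' → T (meetsᵇ e e') → Meet e e'
meetsᵇ-sound (p , q) e' t with Equivalence.to T-∨ t
... | inj₁ p∈ = p , inj₁ refl , ∈ᵇ-sound e' p∈
... | inj₂ q∈ = q , inj₂ refl , ∈ᵇ-sound e' q∈

compatibleᵇ : ∀ {r c} → Vertex × Vertex → Entry r c → Vertex × Vertex → Entry r c → Bool
compatibleᵇ e nothing e' nothing = false
compatibleᵇ e nothing e' (just _) = true
compatibleᵇ e (just _) e' nothing = true
compatibleᵇ e (just (x , y)) e' (just (x' , y')) =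
  not ((x == x') ∧ (y == y')) ∧ (not (meetsᵇ e e') ∨ (not (x == x') ∧ not (y == y')))

compatibleᵇ-complete : ∀ {r c} e (a : Entry r c) e' a' → Compatible e a e' a' → T (compatibleᵇ e a e' a')
compatibleᵇ-complete e nothing e' (just _) _ = tt
compatibleᵇ-complete e (just _) e' nothing _ = tt
compatibleᵇ-complete e (just (x , y)) e' (just (x' , y')) (distinct , separated) =
  Equivalence.from T-∧ (different-cells , Equivalence.from T-∨ separated-if-meet)
  where
  different-cells : T (not ((x == x') ∧ (y == y')))
  different-cells = ¬T⇒T-not λ same → let (same-x , same-y) = Equivalence.to T-∧ same in
    distinct (==⇒≡ same-x , ==⇒≡ same-y)

  separated-if-meet : T (not (meetsᵇ e e')) ⊎ T (not (x == x') ∧ not (y == y'))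
  separated-if-meet with meetsᵇ e e' in meets
  ... | false = inj₁ tt
  ... | true = let (x≢x' , y≢y') = separated (meetsᵇ-sound e e' (subst T (sym meets) tt)) in
    inj₂ (Equivalence.from T-∧ (≢⇒T-not== x≢x' , ≢⇒T-not== y≢y'))

entries : List (Entry 5 5)
entries = nothing ∷ map just (cartesianProduct (allFin 5) (allFin 5))

entries-complete : ∀ a → a ∈ entries
entries-complete nothing = here refl
entries-complete (just (x , y)) = there (∈-map⁺ just (∈-cartesianProduct⁺ (∈-allFin x) (∈-allFin y)))

open Backtrack ends _≈ₚ_ compatibleᵇ entries

starEdges : Fin 3 → List Edge
starEdges v = map (star v) (allFin 5)

otherEdges : Fin 3 → List Edge
otherEdges v = filter (λ e → ¬? (any? λ k → star v k ≟ e)) (allFin 15)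

diagonalStar : Fin 3 → List ((Vertex × Vertex) × Entry 5 5)
diagonalStar v = map (λ k → ends (star v k) , just (k , k)) (allFin 5)

-- The computation: the diagonal star admits no completion.
diagonalStar-inextendable : ∀ v → ¬ T (extendable (diagonalStar v) (otherEdges v))
diagonalStar-inextendable 0F ()
diagonalStar-inextendable 1F ()
diagonalStar-inextendable 2F ()

no-normalised-array : ∀ v (ψ : Edge → Entry 5 5) → ValidArray ψ → Normalised v ψ → ⊥
no-normalised-array v ψ valid normalised =
  diagonalStar-inextendable v (subst (λ placed → T (extendable placed (otherEdges v))) star-graph
    (extendable-solution ψ (entries-complete ∘ ψ) solution (starEdges v) (otherEdges v)))
  where
  solution : ∀ e e' → T ((ends e ≈ₚ ends e') ∨ compatibleᵇ (ends e) (ψ e) (ends e') (ψ e'))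
  solution e e' with e ≟ e'
  ... | yes refl = Equivalence.from T-∨ (inj₁ (≈ₚ-refl (ends e)))
  ... | no e≢e' = Equivalence.from T-∨ (inj₂ (compatibleᵇ-complete _ (ψ e) _ (ψ e') (valid e e' e≢e')))

  star-graph : graph ψ (starEdges v) ≡ diagonalStar v
  star-graph = begin
    graph ψ (map (star v) (allFin 5))
      ≡⟨ map-∘ {g = λ e → ends e , ψ e} {f = star v} (allFin 5) ⟨
    map (λ k → ends (star v k) , ψ (star v k)) (allFin 5)
      ≡⟨ map-cong (λ k → cong (ends (star v k) ,_) (normalised k)) (allFin 5) ⟩
    diagonalStar v
      ∎
    where open ≡-Reasoning

module PackingArray {v₃} {L : List (Block 6 5 v₃)} (P : IsPacking L) where
  open IsPacking P

  edge : Fin (length L) → Edge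
  edge i = proj₁ (edgeOf (fst₁ (lookup L i)) (snd₁ (lookup L i)) (ordered (lookup L i)))

  edge-ends : ∀ i → ends (edge i) ≡ (fst₁ (lookup L i) , snd₁ (lookup L i))
  edge-ends i = proj₂ (edgeOf (fst₁ (lookup L i)) (snd₁ (lookup L i)) (ordered (lookup L i)))

  edge-injective : Injective _≡_ _≡_ edge
  edge-injective {i} {j} eq =
    cond-B (fst₁ (lookup L j)) (snd₁ (lookup L j)) (ordered (lookup L j)) i j
      (cong proj₁ same-ends , cong proj₂ same-ends) (refl , refl)
    where
    same-ends : (fst₁ (lookup L i) , snd₁ (lookup L i)) ≡ (fst₁ (lookup L j) , snd₁ (lookup L j))
    same-ends = trans (sym (edge-ends i)) (trans (cong ends eq) (edge-ends j))

  at-most-15 : length L ≤ 15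
  at-most-15 = injective⇒≤ edge-injective

  ∈-block : ∀ i {a} → a ∈ₚ ends (edge i) → a ∈B lookup L i
  ∈-block i {a} = subst (a ∈ₚ_) (edge-ends i)

  Used : Pred Edge 0ℓ
  Used e = ∃ λ i → edge i ≡ e

  used? : Decidable Used
  used? e = any? λ i → edge i ≟ e

  cell : Fin (length L) → Fin 5 × Fin v₃
  cell i = x (lookup L i) , y (lookup L i)

  cells-compatible : ∀ i j → i ≢ j → Compatible (ends (edge i)) (just (cell i)) (ends (edge j)) (just (cell j))
  cells-compatible i j i≢j =
      (λ (same-x , same-y) → i≢j (cond-23 _ _ i j (same-x , same-y) (refl , refl)))
    , λ (a , a∈i , a∈j) →
        (λ same-x → i≢j (cond-12 a _ i j (∈-block i a∈i , same-x) (∈-block j a∈j , refl)))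
      , (λ same-y → i≢j (cond-13 a _ i j (∈-block i a∈i , same-y) (∈-block j a∈j , refl)))

  entry : ∀ {e} → Dec (Used e) → Entry 5 v₃
  entry (yes (i , _)) = just (cell i)
  entry (no _) = nothing

  array : Edge → Entry 5 v₃
  array e = entry (used? e)

  array-used : ∀ i → array (edge i) ≡ just (cell i)
  array-used i with used? (edge i)
  ... | no unused = ⊥-elim (unused (i , refl))
  ... | yes (j , eq) with edge-injective eq
  ...   | refl = refl

  entry-compatible : ∀ {e e'} → e ≢ e' → (¬ Used e → ¬ Used e' → e ≡ e') →
    (d : Dec (Used e)) (d' : Dec (Used e')) → Compatible (ends e) (entry d) (ends e') (entry d')
  entry-compatible e≢e' _ (yes (i , refl)) (yes (j , refl)) = cells-compatible i j (e≢e' ∘ cong edge)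
  entry-compatible e≢e' _ (yes _) (no _) = tt
  entry-compatible e≢e' _ (no _) (yes _) = tt
  entry-compatible e≢e' unused-equal (no ¬u) (no ¬u') = e≢e' (unused-equal ¬u ¬u')

  array-valid : (∀ e e' → ¬ Used e → ¬ Used e' → e ≡ e') → ValidArray array
  array-valid atMostOne e e' e≢e' = entry-compatible e≢e' (atMostOne e e') (used? e) (used? e')

  used-occupied : ∀ {e} → Used e → ∃ λ c → array e ≡ just c
  used-occupied (i , refl) = cell i , array-used i

-- The upper bound D ≤ 13 for v₃ = 5: two unused edges cost two blocks;
-- otherwise a full star normalises the array, which the search excludes.
module _ {L : List (Block 6 5 5)} (P : IsPacking L) where
  open PackingArray P

  at-most-13 : length L ≤ 13
  at-most-13 with twoFailures⊎atMostOne used?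
  ... | inj₁ (e , e' , e≢e' , ¬u , ¬u') =
    missing-two⇒≤ edge-injective e≢e' (λ i → ¬u ∘ (i ,_)) (λ i → ¬u' ∘ (i ,_))
  ... | inj₂ atMostOne with full-star used? atMostOne
  ...   | v , used with normalise v (array-valid atMostOne) (used-occupied ∘ used)
  ...     | ψ , valid , normalised = ⊥-elim (no-normalised-array v ψ valid normalised)

atMostOne? : ∀ {A : Set} (L : List A) {P : Fin (length L) → Set} → (∀ i → Dec (P i)) → Dec (AtMostOne L P)
atMostOne? L P? = all? λ i → all? λ j → P? i →-dec (P? j →-dec (i ≟ j))

_∈B?_ : ∀ {v₁ v₂ v₃} (a : Fin v₁) (β : Block v₁ v₂ v₃) → Dec (a ∈B β)
a ∈B? β = (a ≟ fst₁ β) ⊎-dec (a ≟ snd₁ β)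

isPacking? : ∀ {v₁ v₂ v₃} (L : List (Block v₁ v₂ v₃)) → Dec (IsPacking L)
isPacking? {v₁} {v₂} {v₃} L =
  map′ toPacking fromPacking (condB? ×-dec cond12? ×-dec cond13? ×-dec cond23?)
  where
  CondB Cond12 Cond13 Cond23 : Set
  CondB = ∀ (a b : Fin v₁) → toℕ a < toℕ b →
    AtMostOne L (λ i → (fst₁ (lookup L i) ≡ a) × (snd₁ (lookup L i) ≡ b))
  Cond12 = ∀ (a : Fin v₁) (x₀ : Fin v₂) → AtMostOne L (λ i → (a ∈B lookup L i) × (x (lookup L i) ≡ x₀))
  Cond13 = ∀ (a : Fin v₁) (y₀ : Fin v₃) → AtMostOne L (λ i → (a ∈B lookup L i) × (y (lookup L i) ≡ y₀))
  Cond23 = ∀ (x₀ : Fin v₂) (y₀ : Fin v₃) → AtMostOne L (λ i → (x (lookup L i) ≡ x₀) × (y (lookup L i) ≡ y₀))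

  condB? : Dec CondB
  condB? = all? λ a → all? λ b → (toℕ a <? toℕ b) →-dec
    atMostOne? L (λ i → (fst₁ (lookup L i) ≟ a) ×-dec (snd₁ (lookup L i) ≟ b))
  cond12? : Dec Cond12
  cond12? = all? λ a → all? λ x₀ → atMostOne? L (λ i → (a ∈B? lookup L i) ×-dec (x (lookup L i) ≟ x₀))
  cond13? : Dec Cond13
  cond13? = all? λ a → all? λ y₀ → atMostOne? L (λ i → (a ∈B? lookup L i) ×-dec (y (lookup L i) ≟ y₀))
  cond23? : Dec Cond23
  cond23? = all? λ x₀ → all? λ y₀ → atMostOne? L (λ i → (x (lookup L i) ≟ x₀) ×-dec (y (lookup L i) ≟ y₀))

  toPacking : CondB × Cond12 × Cond13 × Cond23 → IsPacking L
  toPacking (cB , c12 , c13 , c23) = record { cond-B = cB ; cond-12 = c12 ; cond-13 = c13 ; cond-23 = c23 }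

  fromPacking : IsPacking L → CondB × Cond12 × Cond13 × Cond23
  fromPacking P = cond-B , cond-12 , cond-13 , cond-23
    where open IsPacking P

relabelY : ∀ {v₁ v₂ v₃ w₃} → (Fin v₃ → Fin w₃) → Block v₁ v₂ v₃ → Block v₁ v₂ w₃
relabelY ι β = block (fst₁ β) (snd₁ β) (ordered β) (x β) (ι (y β))

lookup-map : ∀ {A B : Set} (f : A → B) (xs : List A) i →
  lookup (map f xs) i ≡ f (lookup xs (cast (length-map f xs) i))
lookup-map f (_ ∷ xs) zero = refl
lookup-map f (_ ∷ xs) (suc i) = lookup-map f xs i

atMostOne-map : ∀ {A B : Set} (f : A → B) (xs : List A) (P : B → Set) →
  (∀ i j → P (f (lookup xs i)) → P (f (lookup xs j)) → i ≡ j) →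
  AtMostOne (map f xs) (λ i → P (lookup (map f xs) i))
atMostOne-map f xs P unique i j Pi Pj = cast-injective
  (unique _ _ (subst P (lookup-map f xs i) Pi) (subst P (lookup-map f xs j) Pj))
  where
  cast-injective : ∀ {i j} → cast (length-map f xs) i ≡ cast (length-map f xs) j → i ≡ j
  cast-injective {i} {j} eq = toℕ-injective (begin
    toℕ i                          ≡⟨ toℕ-cast (length-map f xs) i ⟨
    toℕ (cast (length-map f xs) i) ≡⟨ cong toℕ eq ⟩
    toℕ (cast (length-map f xs) j) ≡⟨ toℕ-cast (length-map f xs) j ⟩
    toℕ j                          ∎)
    where open ≡-Reasoning

relabelY-packing : ∀ {v₁ v₂ v₃ w₃} {ι : Fin v₃ → Fin w₃} {L : List (Block v₁ v₂ v₃)} →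
  Injective _≡_ _≡_ ι → IsPacking L → IsPacking (map (relabelY ι) L)
relabelY-packing {ι = ι} {L} ι-inj P = record
  { cond-B = λ a b a<b →
      atMostOne-map (relabelY ι) L (λ β → (fst₁ β ≡ a) × (snd₁ β ≡ b)) (cond-B a b a<b)
  ; cond-12 = λ a x₀ → atMostOne-map (relabelY ι) L (λ β → (a ∈B β) × (x β ≡ x₀)) (cond-12 a x₀)
  ; cond-13 = λ a y₀ → atMostOne-map (relabelY ι) L (λ β → (a ∈B β) × (y β ≡ y₀))
      λ i j (a∈i , yi) (a∈j , yj) →
      cond-13 a (y (lookup L j)) i j (a∈i , ι-inj (trans yi (sym yj))) (a∈j , refl)
  ; cond-23 = λ x₀ y₀ → atMostOne-map (relabelY ι) L (λ β → (x β ≡ x₀) × (y β ≡ y₀))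
      λ i j (xi , yi) (xj , yj) →
      cond-23 x₀ (y (lookup L j)) i j (xi , ι-inj (trans yi (sym yj))) (xj , refl)
  }
  where open IsPacking P

blockOn : ∀ {v₃} → Edge → Fin 5 → Fin v₃ → Block 6 5 v₃
blockOn e x₀ y₀ = block (proj₁ (ends e)) (proj₂ (ends e)) (ends-ordered e) x₀ y₀

-- Optimal packings: 13 blocks for v₃ = 5 (edges 11 and 12 unused), and 15
-- blocks for v₃ = 6, one on every edge.
packing13 : List (Block 6 5 5)
packing13 =
  blockOn (# 0) (# 0) (# 0) ∷ blockOn (# 1) (# 1) (# 1) ∷ blockOn (# 2) (# 2) (# 2) ∷
  blockOn (# 3) (# 3) (# 3) ∷ blockOn (# 4) (# 4) (# 4) ∷ blockOn (# 5) (# 2) (# 3) ∷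
  blockOn (# 6) (# 1) (# 4) ∷ blockOn (# 7) (# 4) (# 1) ∷ blockOn (# 8) (# 3) (# 2) ∷
  blockOn (# 9) (# 3) (# 0) ∷ blockOn (# 10) (# 0) (# 2) ∷ blockOn (# 13) (# 0) (# 1) ∷
  blockOn (# 14) (# 1) (# 0) ∷ []

packing15 : List (Block 6 5 6)
packing15 =
  blockOn (# 0) (# 0) (# 0) ∷ blockOn (# 1) (# 1) (# 1) ∷ blockOn (# 2) (# 2) (# 2) ∷
  blockOn (# 3) (# 3) (# 3) ∷ blockOn (# 4) (# 4) (# 4) ∷ blockOn (# 5) (# 2) (# 3) ∷
  blockOn (# 6) (# 3) (# 1) ∷ blockOn (# 7) (# 4) (# 2) ∷ blockOn (# 8) (# 1) (# 5) ∷
  blockOn (# 9) (# 4) (# 0) ∷ blockOn (# 10) (# 0) (# 5) ∷ blockOn (# 11) (# 3) (# 2) ∷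
  blockOn (# 12) (# 1) (# 4) ∷ blockOn (# 13) (# 0) (# 3) ∷ blockOn (# 14) (# 2) (# 0) ∷ []

abstract
  packing13-isPacking : IsPacking packing13
  packing13-isPacking = from-yes (isPacking? packing13)

  packing15-isPacking : IsPacking packing15
  packing15-isPacking = from-yes (isPacking? packing15)

lemma5p26 : ∀ (v₃ : ℕ) → 5 ≤ v₃ →
    (v₃ ≡ 5 → IsD 6 5 v₃ 13) × (6 ≤ v₃ → IsD 6 5 v₃ 15)
lemma5p26 v₃ _ = exactly13 , exactly15
  where
  exactly13 : v₃ ≡ 5 → IsD 6 5 v₃ 13
  exactly13 refl = (packing13 , packing13-isPacking , refl) , λ _ → at-most-13

  exactly15 : 6 ≤ v₃ → IsD 6 5 v₃ 15
  exactly15 6≤v₃ = (map (relabelY ι) packing15 , relabelY-packing ι-injective packing15-isPacking , refl)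
                 , λ _ → PackingArray.at-most-15
    where
    ι : Fin 6 → Fin v₃
    ι y₀ = inject≤ y₀ 6≤v₃
    ι-injective : Injective _≡_ _≡_ ι
    ι-injective = inject≤-injective 6≤v₃ 6≤v₃ _ _
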